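{- For every closed $\psi\in\mathrm{ftmuS}$, the monitor $m(\psi)$ is sound and violation-complete for $\psi$ over finfinite traces. For every closed $\psi\in\mathrm{ftmuC}$, $m(\psi)$ is sound and satisfaction-complete for $\psi$ over finfinite traces.
   Context: Fix a finite set $\mathit{Act}$ of actions and $\tau\notin\mathit{Act}$. Fragments of recHML (formulas guarded): $\mathrm{ftmuS}$: $\psi::=\mathrm{tt}\mid\mathrm{ff}\mid[A]\psi\mid\psi\vee\psi\mid\psi\wedge\psi\mid\max X.\psi\mid X$; $\mathrm{ftmuC}$: $\psi::=\mathrm{tt}\mid\mathrm{ff}\mid\langle A\rangle\psi\mid\psi\vee\psi\mid\psi\wedge\psi\mid\min X.\psi\mid X$, $A\subseteq\mathit{Act}$. Finfinite semantics over $\mathit{FTrc}=\mathit{Act}^*\cup\mathit{Act}^\omega$: $[\![\mathrm{tt}]\!]_F=\mathit{FTrc}$, $[\![\mathrm{ff}]\!]_F=\emptyset$, $\vee,\wedge$ union/intersection, $[\![\langle A\rangle\psi]\!]_F=\{ag\mid a\in A,g\in[\![\psi]\!]_F\}$, $[\![[A]\psi]\!]_F=\{g\mid\forall a\in A,\forall g'.\ g=ag'\Rightarrow g'\in[\![\psi]\!]_F\}$, least/greatest fixpoints as intersection of pre-fixpoints/union of post-fixpoints. Parallel monitors: $m,n::=v\mid a.m\mid m+n\mid\mathrm{rec}\,x.m\mid x\mid m\otimes n\mid m\oplus n$, $v\in\{\mathsf{end},\mathsf{no},\mathsf{yes}\}$, with transitions: $a.m\xrightarrow{a}m$; $\mathrm{rec}\,x.m\xrightarrow{\tau}m[\mathrm{rec}\,x.m/x]$;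 summands of $+$ may move; $v\xrightarrow{a}v$; for $\odot\in\{\otimes,\oplus\}$: synchronous $a$-steps of both components, interleaved $\tau$-steps of either component, $\mathsf{end}\odot\mathsf{end}\xrightarrow{\tau}\mathsf{end}$, $\mathsf{yes}\otimes m\xrightarrow{\tau}m$, $\mathsf{no}\otimes m\xrightarrow{\tau}\mathsf{no}$, $\mathsf{no}\oplus m\xrightarrow{\tau}m$, $\mathsf{yes}\oplus m\xrightarrow{\tau}\mathsf{yes}$ and their symmetric versions. $m\xRightarrow{s}n$ denotes weak transitions along $s\in\mathit{Act}^*$. Synthesis: $m(\mathrm{tt})=\mathsf{yes}$, $m(\mathrm{ff})=\mathsf{no}$, $m([A]\psi)=\sum_{a\in A}a.m(\psi)+\sum_{a\in\mathit{Act}\setminus A}a.\mathsf{yes}$, $m(\langle A\rangle\psi)=\sum_{a\in A}a.m(\psi)+\sum_{a\in\mathit{Act}\setminus A}a.\mathsf{no}$ (empty sums omitted), $m(\psi_1\wedge\psi_2)=m(\psi_1)\otimes m(\psi_2)$, $m(\psi_1\vee\psi_2)=m(\psi_1)\oplus m(\psi_2)$, $m(\max X.\psi)=m(\min X.\psi)=\mathrm{rec}\,x.m(\psi)$, $m(X)=x$. A monitor rejects (resp. accepts) $g\in\mathit{FTrc}$ if $m\xRightarrow{s}\mathsf{no}$ (resp. $\mathsf{yes}$) for a finite prefix $s$ of $g$. Sound for $\psi$ over finfinite traces: rejection of $g$ implies $g\notin[\![\psi]\!]_F$ and acceptance implies $g\in[\![\psi]\!]_F$; violation-complete: $g\notin[\![\psi]\!]_F$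 implies rejection; satisfaction-complete: $g\in[\![\psi]\!]_F$ implies acceptance. -}

module Defs where

open import Level using (Lift; lift) renaming (suc to lsuc; zero to 0ℓ)
open import Data.Nat using (ℕ; zero; suc; _≟_)
open import Data.Bool using (Bool; true; false; not; if_then_else_)
open import Data.Fin using (Fin)
open import Data.Fin.Subset using (Subset; _∈_; _∉_)
open import Data.Vec using (lookup)
open import Data.List using (List; []; _∷_; _++_; map; filterᵇ; allFin)
open import Data.List.Membership.Propositional renaming (_∈_ to _∈ᴸ_)
open import Data.Product using (Σ; ∃; _×_; _,_)
open import Data.Unit.Polymorphic using (⊤)
open import Data.Empty.Polymorphic using (⊥)
open import Relation.Nullary using (¬_) renaming (yes to yes′; no to no′)
open import Relation.Binary.PropositionalEquality using (_≡_; _≢_)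

Var : Set
Var = ℕ

-- recHML formulas (both modalities, both fixpoints); the fragments
-- ftmuS and ftmuC are carved out by the predicates InS / InC below.

data Form (n : ℕ) : Set where
  tt ff : Form n
  box  : Subset n → Form n → Form n
  dia  : Subset n → Form n → Form n
  _∨ᶠ_ _∧ᶠ_ : Form n → Form n → Form n
  max  : Var → Form n → Form n
  min  : Var → Form n → Form n
  var  : Var → Form n

data InS {n : ℕ} : Form n → Set where
  tt  : InS tt
  ff  : InS ff
  box : ∀ {A ψ} → InS ψ → InS (box A ψ)
  or  : ∀ {ψ φ} → InS ψ → InS φ → InS (ψ ∨ᶠ φ)
  and : ∀ {ψ φ} → InS ψ → InS φ → InS (ψ ∧ᶠ φ)
  max : ∀ {X ψ} → InS ψ → InS (max X ψ)
  var : ∀ {X} → InS (var X)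

data InC {n : ℕ} : Form n → Set where
  tt  : InC tt
  ff  : InC ff
  dia : ∀ {A ψ} → InC ψ → InC (dia A ψ)
  or  : ∀ {ψ φ} → InC ψ → InC φ → InC (ψ ∨ᶠ φ)
  and : ∀ {ψ φ} → InC ψ → InC φ → InC (ψ ∧ᶠ φ)
  min : ∀ {X ψ} → InC ψ → InC (min X ψ)
  var : ∀ {X} → InC (var X)

data Scoped {n : ℕ} (Γ : List Var) : Form n → Set where
  tt  : Scoped Γ tt
  ff  : Scoped Γ ff
  box : ∀ {A ψ} → Scoped Γ ψ → Scoped Γ (box A ψ)
  dia : ∀ {A ψ} → Scoped Γ ψ → Scoped Γ (dia A ψ)
  or  : ∀ {ψ φ} → Scoped Γ ψ → Scoped Γ φ → Scoped Γ (ψ ∨ᶠ φ)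
  and : ∀ {ψ φ} → Scoped Γ ψ → Scoped Γ φ → Scoped Γ (ψ ∧ᶠ φ)
  max : ∀ {X ψ} → Scoped (X ∷ Γ) ψ → Scoped Γ (max X ψ)
  min : ∀ {X ψ} → Scoped (X ∷ Γ) ψ → Scoped Γ (min X ψ)
  var : ∀ {X} → X ∈ᴸ Γ → Scoped Γ (var X)

Closed : ∀ {n} → Form n → Set
Closed = Scoped []

data GuardedIn {n : ℕ} (X : Var) : Form n → Set where
  tt  : GuardedIn X tt
  ff  : GuardedIn X ff
  box : ∀ {A ψ} → GuardedIn X (box A ψ)
  dia : ∀ {A ψ} → GuardedIn X (dia A ψ)
  or  : ∀ {ψ φ} → GuardedIn X ψ → GuardedIn X φ → GuardedIn X (ψ ∨ᶠ φ)
  and : ∀ {ψ φ} → GuardedIn X ψ → GuardedIn X φ → GuardedIn X (ψ ∧ᶠ φ)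
  max-shadow : ∀ {ψ} → GuardedIn X (max X ψ)
  max : ∀ {Y ψ} → GuardedIn X ψ → GuardedIn X (max Y ψ)
  min-shadow : ∀ {ψ} → GuardedIn X (min X ψ)
  min : ∀ {Y ψ} → GuardedIn X ψ → GuardedIn X (min Y ψ)
  var : ∀ {Y} → X ≢ Y → GuardedIn X (var Y)

data Guarded {n : ℕ} : Form n → Set where
  tt  : Guarded tt
  ff  : Guarded ff
  box : ∀ {A ψ} → Guarded ψ → Guarded (box A ψ)
  dia : ∀ {A ψ} → Guarded ψ → Guarded (dia A ψ)
  or  : ∀ {ψ φ} → Guarded ψ → Guarded φ → Guarded (ψ ∨ᶠ φ)
  and : ∀ {ψ φ} → Guarded ψ → Guarded φ → Guarded (ψ ∧ᶠ φ)
  max : ∀ {X ψ} → GuardedIn X ψ → Guarded ψ → Guarded (max X ψ)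
  min : ∀ {X ψ} → GuardedIn X ψ → Guarded ψ → Guarded (min X ψ)
  var : ∀ {X} → Guarded (var X)

data FTrc (n : ℕ) : Set where
  fin : List (Fin n) → FTrc n
  inf : (ℕ → Fin n) → FTrc n

tailω : ∀ {n} → (ℕ → Fin n) → (ℕ → Fin n)
tailω f i = f (suc i)

TSet : ℕ → Set₁
TSet n = FTrc n → Set

Env : ℕ → Set₁
Env n = Var → TSet n

_[_↦_] : ∀ {n} → Env n → Var → TSet n → Env n
(ρ [ X ↦ S ]) Y with X ≟ Y
... | yes′ _ = S
... | no′  _ = ρ Y

Box : ∀ {n} → Subset n → (FTrc n → Set₁) → FTrc n → Set₁
Box A P (fin [])      = ⊤
Box A P (fin (a ∷ s)) = a ∈ A → P (fin s)
Box A P (inf f)       = f zero ∈ A → P (inf (tailω f))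

Dia : ∀ {n} → Subset n → (FTrc n → Set₁) → FTrc n → Set₁
Dia A P (fin [])      = ⊥
Dia A P (fin (a ∷ s)) = a ∈ A × P (fin s)
Dia A P (inf f)       = f zero ∈ A × P (inf (tailω f))

-- Finfinite semantics ⟦ψ⟧_F under an environment.
-- max: union of post-fixpoints; min: intersection of pre-fixpoints.
⟦_⟧ : ∀ {n} → Form n → Env n → FTrc n → Set₁
⟦ tt ⟧ ρ g = ⊤
⟦ ff ⟧ ρ g = ⊥
⟦ box A ψ ⟧ ρ g = Box A (⟦ ψ ⟧ ρ) g
⟦ dia A ψ ⟧ ρ g = Dia A (⟦ ψ ⟧ ρ) g
⟦ ψ ∨ᶠ φ ⟧ ρ g = ⟦ ψ ⟧ ρ g Data.Sum.⊎ ⟦ φ ⟧ ρ g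
  where import Data.Sum
⟦ ψ ∧ᶠ φ ⟧ ρ g = ⟦ ψ ⟧ ρ g × ⟦ φ ⟧ ρ g
⟦ max X ψ ⟧ ρ g =
  Σ (TSet _) λ S → (∀ h → S h → ⟦ ψ ⟧ (ρ [ X ↦ S ]) h) × S g
⟦ min X ψ ⟧ ρ g =
  (S : TSet _) → (∀ h → ⟦ ψ ⟧ (ρ [ X ↦ S ]) h → S h) → S g
⟦ var X ⟧ ρ g = Lift (lsuc 0ℓ) (ρ X g)

-- empty environment (irrelevant for closed formulas)
ρ₀ : ∀ {n} → Env n
ρ₀ X g = Data.Empty.⊥
  where import Data.Empty

data Mon (n : ℕ) : Set where
  end no yes : Mon n
  _·_  : Fin n → Mon n → Mon n
  _+ᵐ_ : Mon n → Mon n → Mon n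
  rec  : Var → Mon n → Mon n
  var  : Var → Mon n
  _⊗_ _⊕_ : Mon n → Mon n → Mon n

data Verdict {n : ℕ} : Mon n → Set where
  end : Verdict end
  no  : Verdict no
  yes : Verdict yes

_[_/_] : ∀ {n} → Mon n → Mon n → Var → Mon n
end [ p / x ] = end
no  [ p / x ] = no
yes [ p / x ] = yes
(a · m) [ p / x ] = a · (m [ p / x ])
(m +ᵐ m') [ p / x ] = (m [ p / x ]) +ᵐ (m' [ p / x ])
rec y m [ p / x ] with x ≟ y
... | yes′ _ = rec y m
... | no′  _ = rec y (m [ p / x ])
var y [ p / x ] with x ≟ y
... | yes′ _ = p
... | no′  _ = var y
(m ⊗ m') [ p / x ] = (m [ p / x ]) ⊗ (m' [ p / x ])
(m ⊕ m') [ p / x ] = (m [ p / x ]) ⊕ (m' [ p / x ])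

data Lab (n : ℕ) : Set where
  act : Fin n → Lab n
  τ   : Lab n

infix 4 _─[_]→_
data _─[_]→_ {n : ℕ} : Mon n → Lab n → Mon n → Set where
  pref  : ∀ {a m} → (a · m) ─[ act a ]→ m
  rec   : ∀ {x m} → rec x m ─[ τ ]→ (m [ rec x m / x ])
  sumL  : ∀ {m m' p α} → m ─[ α ]→ m' → (m +ᵐ p) ─[ α ]→ m'
  sumR  : ∀ {m p p' α} → p ─[ α ]→ p' → (m +ᵐ p) ─[ α ]→ p'
  verd  : ∀ {v a} → Verdict v → v ─[ act a ]→ v
  ⊗sync : ∀ {m m' p p' a} → m ─[ act a ]→ m' → p ─[ act a ]→ p' →
          (m ⊗ p) ─[ act a ]→ (m' ⊗ p')
  ⊗τL   : ∀ {m m' p} → m ─[ τ ]→ m' → (m ⊗ p) ─[ τ ]→ (m' ⊗ p)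
  ⊗τR   : ∀ {m p p'} → p ─[ τ ]→ p' → (m ⊗ p) ─[ τ ]→ (m ⊗ p')
  ⊗end  : (end ⊗ end) ─[ τ ]→ end
  ⊗yesL : ∀ {m} → (yes ⊗ m) ─[ τ ]→ m
  ⊗yesR : ∀ {m} → (m ⊗ yes) ─[ τ ]→ m
  ⊗noL  : ∀ {m} → (no ⊗ m) ─[ τ ]→ no
  ⊗noR  : ∀ {m} → (m ⊗ no) ─[ τ ]→ no
  ⊕sync : ∀ {m m' p p' a} → m ─[ act a ]→ m' → p ─[ act a ]→ p' →
          (m ⊕ p) ─[ act a ]→ (m' ⊕ p')
  ⊕τL   : ∀ {m m' p} → m ─[ τ ]→ m' → (m ⊕ p) ─[ τ ]→ (m' ⊕ p)
  ⊕τR   : ∀ {m p p'} → p ─[ τ ]→ p' → (m ⊕ p) ─[ τ ]→ (m ⊕ p')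
  ⊕end  : (end ⊕ end) ─[ τ ]→ end
  ⊕noL  : ∀ {m} → (no ⊕ m) ─[ τ ]→ m
  ⊕noR  : ∀ {m} → (m ⊕ no) ─[ τ ]→ m
  ⊕yesL : ∀ {m} → (yes ⊕ m) ─[ τ ]→ yes
  ⊕yesR : ∀ {m} → (m ⊕ yes) ─[ τ ]→ yes

infix 4 _═[_]⇒_
data _═[_]⇒_ {n : ℕ} : Mon n → List (Fin n) → Mon n → Set where
  done : ∀ {m} → m ═[ [] ]⇒ m
  tau  : ∀ {m m' p s} → m ─[ τ ]→ m' → m' ═[ s ]⇒ p → m ═[ s ]⇒ p
  step : ∀ {m m' p a s} → m ─[ act a ]→ m' → m' ═[ s ]⇒ p →
         m ═[ a ∷ s ]⇒ p

-- right-nested sum of a list of monitors (empty sums omitted;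
-- the empty list never arises when Act is nonempty)
Sum : ∀ {n} → List (Mon n) → Mon n
Sum []           = end
Sum (m ∷ [])     = m
Sum (m ∷ p ∷ ms) = m +ᵐ Sum (p ∷ ms)

inA : ∀ {n} → Subset n → Fin n → Bool
inA A a = lookup A a

guardSum : ∀ {n} → Subset n → Mon n → Mon n → Mon n
guardSum {n} A m v =
  Sum (map (λ a → a · m) (filterᵇ (inA A) (allFin n))
       ++ map (λ a → a · v) (filterᵇ (λ a → not (inA A a)) (allFin n)))

synth : ∀ {n} → Form n → Mon n
synth tt          = yes
synth ff          = no
synth (box A ψ)   = guardSum A (synth ψ) yes
synth (dia A ψ)   = guardSum A (synth ψ) no
synth (ψ ∧ᶠ φ)    = synth ψ ⊗ synth φ
synth (ψ ∨ᶠ φ)    = synth ψ ⊕ synth φ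
synth (max X ψ)   = rec X (synth ψ)
synth (min X ψ)   = rec X (synth ψ)
synth (var X)     = var X

Prefix : ∀ {n} → List (Fin n) → FTrc n → Set
Prefix [] g = Data.Unit.⊤
  where import Data.Unit
Prefix (a ∷ s) (fin [])      = Data.Empty.⊥
  where import Data.Empty
Prefix (a ∷ s) (fin (b ∷ l)) = a ≡ b × Prefix s (fin l)
Prefix (a ∷ s) (inf f)       = a ≡ f zero × Prefix s (inf (tailω f))

Rejects : ∀ {n} → Mon n → FTrc n → Set
Rejects m g = ∃ λ s → Prefix s g × m ═[ s ]⇒ no

Accepts : ∀ {n} → Mon n → FTrc n → Set
Accepts m g = ∃ λ s → Prefix s g × m ═[ s ]⇒ yes

Sound : ∀ {n} → Mon n → Form n → Set₁
Sound m ψ = (∀ g → Rejects m g → ¬ ⟦ ψ ⟧ ρ₀ g)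
          × (∀ g → Accepts m g → ⟦ ψ ⟧ ρ₀ g)

ViolationComplete : ∀ {n} → Mon n → Form n → Set₁
ViolationComplete m ψ = ∀ g → ¬ ⟦ ψ ⟧ ρ₀ g → Rejects m g

SatisfactionComplete : ∀ {n} → Mon n → Form n → Set₁
SatisfactionComplete m ψ = ∀ g → ⟦ ψ ⟧ ρ₀ g → Accepts m g

-- Write m(φ)[δ] for the synthesised monitor of φ with each free variable X replaced by δ X.
-- Unfolding rec X.m(φ)[δ] yields m(φ)[δ, X ↦ rec X.m(φ)[δ]], so all arguments are inductions
-- on φ that relate δ to a semantic environment.
--
-- Soundness is by well-founded induction on the length of the verdict-reaching prefix. Where the
-- verdict works against the fixpoint (rejection at max, acceptance at min), guardedness means X is
-- only reached after a visible action, so the fixpoint formula itself applies on a strictly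
-- shorter prefix; at the other fixpoints the traces on which the monitor does not reject (resp.
-- does accept) within the length bound form a pre-fixpoint (resp. post-fixpoint) of the body.
--
-- Completeness: the traces not rejected by m(max X.φ) form a post-fixpoint and those accepted by
-- m(min X.φ) a pre-fixpoint; excluded middle splits disjunctions. A conjunction rejects as soon as
-- one conjunct does, because the other one, a guarded synthesised monitor, can always follow the
-- trace (dually for disjunctions and acceptance).

module Submission where

open import Defs
open import Level using (suc; zero)
open import Data.Nat using (ℕ)
open import Data.Product using (_×_)
open import Axiom.ExcludedMiddle using (ExcludedMiddle)

open import Level using (Lift; lift; lower)
open import Data.Nat using (_≤_; _<_; _≟_)
open import Data.Nat.Properties using (≤-refl; ≤-trans; <⇒≤; ≤-<-trans)
open import Data.Nat.Induction using (<-wellFounded)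
open import Induction.WellFounded using (Acc; acc)
open import Data.Bool using (T; not; true; false)
open import Data.Bool.Properties using (T-≡; T?)
open import Data.Fin using (Fin)
open import Data.Fin.Subset using (Subset; _∉_) renaming (_∈_ to _∈ˢ_)
open import Data.Fin.Subset.Properties using (_∈?_)
open import Data.Vec.Properties using ([]=⇒lookup; lookup⇒[]=)
open import Data.List using (List; []; _∷_; _++_; map; filterᵇ; allFin; length)
open import Data.List.Properties using (map-++; map-∘)
open import Data.List.Membership.Propositional using (_∈_)
open import Data.List.Membership.Propositional.Properties
  using (∈-++⁻; ∈-++⁺ˡ; ∈-++⁺ʳ; ∈-map∘filter⁻; ∈-map∘filter⁺; ∈-allFin)
open import Data.List.Relation.Unary.Any using (here; there; tail)
open import Data.Product using (∃; ∃₂; _,_; proj₁; proj₂; map₁; map₂) renaming (map to map-×)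
open import Data.Sum using (_⊎_; inj₁; inj₂) renaming (map to map-⊎)
open import Data.Empty using (⊥-elim)
open import Function using (_∘_; Equivalence)
open import Relation.Nullary using (¬_; Dec) renaming (yes to yes′; no to no′)
open import Relation.Nullary.Decidable using (map′; decidable-stable)
open import Relation.Binary.PropositionalEquality

module _ {n : ℕ} where

  private variable
    a : Fin n
    A : Subset n
    s t : List (Fin n)
    g g′ : FTrc n
    P : FTrc n → Set₁
    m m′ m″ p q v w x x′ y y′ : Mon n
    X Y W : Var
    Γ Θ : List Var
    φ ψ : Form n
    δ δ′ : Var → Mon n
    k j : ℕ
    ρ : Env n

  data Cons : Fin n → FTrc n → FTrc n → Set where
    fin : ∀ {a l} → Cons a (fin l) (fin (a ∷ l))
    inf : ∀ {f} → Cons (f 0) (inf (tailω f)) (inf f)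

  Prefix-∷⁺ : Cons a g′ g → Prefix s g′ → Prefix (a ∷ s) g
  Prefix-∷⁺ fin p = refl , p
  Prefix-∷⁺ inf p = refl , p

  Prefix-compare : ∀ s t → Prefix s g → Prefix t g → (∃ λ u → t ≡ s ++ u) ⊎ (∃ λ u → s ≡ t ++ u)
  Prefix-compare []      t       _ _ = inj₁ (t , refl)
  Prefix-compare (a ∷ s) []      _ _ = inj₂ (a ∷ s , refl)
  Prefix-compare {fin (_ ∷ _)} (a ∷ s) (_ ∷ t) (refl , p) (refl , q) =
    map-⊎ (map₂ (cong (a ∷_))) (map₂ (cong (a ∷_))) (Prefix-compare s t p q)
  Prefix-compare {inf _} (a ∷ s) (_ ∷ t) (refl , p) (refl , q) =
    map-⊎ (map₂ (cong (a ∷_))) (map₂ (cong (a ∷_))) (Prefix-compare s t p q)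

  Box-Prefix⁻ : Prefix (a ∷ s) g → Box A P g → a ∈ˢ A → ∃ λ g′ → Prefix s g′ × P g′
  Box-Prefix⁻ {g = fin (_ ∷ l)} (refl , p) b a∈A = fin l , p , b a∈A
  Box-Prefix⁻ {g = inf f}       (refl , p) b a∈A = inf (tailω f) , p , b a∈A

  Box-Prefix⁺ : Prefix (a ∷ s) g → (∀ {g′} → Prefix s g′ → a ∈ˢ A → P g′) → Box A P g
  Box-Prefix⁺ {g = fin (_ ∷ _)} (refl , p) b = b p
  Box-Prefix⁺ {g = inf _}       (refl , p) b = b p

  Dia-Prefix⁻ : Prefix (a ∷ s) g → Dia A P g → a ∈ˢ A × ∃ λ g′ → Prefix s g′ × P g′
  Dia-Prefix⁻ {g = fin (_ ∷ l)} (refl , p) (a∈A , d) = a∈A , fin l , p , d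
  Dia-Prefix⁻ {g = inf f}       (refl , p) (a∈A , d) = a∈A , inf (tailω f) , p , d

  Dia-Prefix⁺ : Prefix (a ∷ s) g → a ∈ˢ A → (∀ {g′} → Prefix s g′ → P g′) → Dia A P g
  Dia-Prefix⁺ {g = fin (_ ∷ _)} (refl , p) a∈A d = a∈A , d p
  Dia-Prefix⁺ {g = inf _}       (refl , p) a∈A d = a∈A , d p

  Box⁺ : (∀ {a g′} → Cons a g′ g → a ∈ˢ A → P g′) → Box A P g
  Box⁺ {g = fin []}      b = _
  Box⁺ {g = fin (_ ∷ _)} b = b fin
  Box⁺ {g = inf _}       b = b inf

  Dia⁻ : Dia A P g → ∃₂ λ a g′ → Cons a g′ g × a ∈ˢ A × P g′
  Dia⁻ {g = fin (a ∷ l)} d = a , fin l , fin , d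
  Dia⁻ {g = inf f}       d = f 0 , inf (tailω f) , inf , d

  data Conclusive : Mon n → Set where
    yes : Conclusive yes
    no  : Conclusive no

  verdict-⇒ : Verdict v → v ═[ s ]⇒ w → w ≡ v
  verdict-⇒ _   done              = refl
  verdict-⇒ end (step (verd _) d) = verdict-⇒ end d
  verdict-⇒ no  (step (verd _) d) = verdict-⇒ no d
  verdict-⇒ yes (step (verd _) d) = verdict-⇒ yes d
  verdict-⇒ end (tau () _)
  verdict-⇒ no  (tau () _)
  verdict-⇒ yes (tau () _)

  verdict-follows : Verdict v → ∀ s → v ═[ s ]⇒ v
  verdict-follows V []      = done
  verdict-follows V (a ∷ s) = step (verd V) (verdict-follows V s)

  end⇏conclusive : Conclusive w → ¬ (end ═[ s ]⇒ w)
  end⇏conclusive yes d with () ← verdict-⇒ end d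
  end⇏conclusive no  d with () ← verdict-⇒ end d

  yes⇏no : ¬ (yes ═[ s ]⇒ no)
  yes⇏no d with () ← verdict-⇒ yes d

  no⇏yes : ¬ (no ═[ s ]⇒ yes)
  no⇏yes d with () ← verdict-⇒ no d

  ⇒-++ : m ═[ s ]⇒ m′ → m′ ═[ t ]⇒ m″ → m ═[ s ++ t ]⇒ m″
  ⇒-++ done       e = e
  ⇒-++ (tau x d)  e = tau x (⇒-++ d e)
  ⇒-++ (step x d) e = step x (⇒-++ d e)

  ⇒-τʳ : m ═[ s ]⇒ m′ → m′ ─[ τ ]→ m″ → m ═[ s ]⇒ m″
  ⇒-τʳ done       t = tau t done
  ⇒-τʳ (tau x d)  t = tau x (⇒-τʳ d t)
  ⇒-τʳ (step x d) t = step x (⇒-τʳ d t)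

  ⇒-extend : Verdict v → m ═[ s ]⇒ v → ∀ u → m ═[ s ++ u ]⇒ v
  ⇒-extend V d u = ⇒-++ d (verdict-follows V u)

  ⊗-⇒ : x ═[ s ]⇒ x′ → y ═[ s ]⇒ y′ → x ⊗ y ═[ s ]⇒ x′ ⊗ y′
  ⊗-⇒ (tau t d)  e          = tau (⊗τL t) (⊗-⇒ d e)
  ⊗-⇒ done       (tau u e)  = tau (⊗τR u) (⊗-⇒ done e)
  ⊗-⇒ (step t d) (tau u e)  = tau (⊗τR u) (⊗-⇒ (step t d) e)
  ⊗-⇒ done       done       = done
  ⊗-⇒ (step t d) (step u e) = step (⊗sync t u) (⊗-⇒ d e)

  ⊕-⇒ : x ═[ s ]⇒ x′ → y ═[ s ]⇒ y′ → x ⊕ y ═[ s ]⇒ x′ ⊕ y′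
  ⊕-⇒ (tau t d)  e          = tau (⊕τL t) (⊕-⇒ d e)
  ⊕-⇒ done       (tau u e)  = tau (⊕τR u) (⊕-⇒ done e)
  ⊕-⇒ (step t d) (tau u e)  = tau (⊕τR u) (⊕-⇒ (step t d) e)
  ⊕-⇒ done       done       = done
  ⊕-⇒ (step t d) (step u e) = step (⊕sync t u) (⊕-⇒ d e)

  ⊗-⇒no⁻ : x ⊗ y ═[ s ]⇒ no → x ═[ s ]⇒ no ⊎ y ═[ s ]⇒ no
  ⊗-⇒no⁻ (tau (⊗τL t) d)       = map-⊎ (tau t) (λ e → e) (⊗-⇒no⁻ d)
  ⊗-⇒no⁻ (tau (⊗τR t) d)       = map-⊎ (λ e → e) (tau t) (⊗-⇒no⁻ d)
  ⊗-⇒no⁻ (tau ⊗end d)          = ⊥-elim (end⇏conclusive no d)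
  ⊗-⇒no⁻ (tau ⊗yesL d)         = inj₂ d
  ⊗-⇒no⁻ (tau ⊗yesR d)         = inj₁ d
  ⊗-⇒no⁻ {s = s} (tau ⊗noL d)  = inj₁ (verdict-follows no s)
  ⊗-⇒no⁻ {s = s} (tau ⊗noR d)  = inj₂ (verdict-follows no s)
  ⊗-⇒no⁻ (step (⊗sync t u) d)  = map-⊎ (step t) (step u) (⊗-⇒no⁻ d)

  ⊕-⇒yes⁻ : x ⊕ y ═[ s ]⇒ yes → x ═[ s ]⇒ yes ⊎ y ═[ s ]⇒ yes
  ⊕-⇒yes⁻ (tau (⊕τL t) d)       = map-⊎ (tau t) (λ e → e) (⊕-⇒yes⁻ d)
  ⊕-⇒yes⁻ (tau (⊕τR t) d)       = map-⊎ (λ e → e) (tau t) (⊕-⇒yes⁻ d)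
  ⊕-⇒yes⁻ (tau ⊕end d)          = ⊥-elim (end⇏conclusive yes d)
  ⊕-⇒yes⁻ (tau ⊕noL d)          = inj₂ d
  ⊕-⇒yes⁻ (tau ⊕noR d)          = inj₁ d
  ⊕-⇒yes⁻ {s = s} (tau ⊕yesL d) = inj₁ (verdict-follows yes s)
  ⊕-⇒yes⁻ {s = s} (tau ⊕yesR d) = inj₂ (verdict-follows yes s)
  ⊕-⇒yes⁻ (step (⊕sync t u) d)  = map-⊎ (step t) (step u) (⊕-⇒yes⁻ d)

  ⊕-⇒no⁻ : x ⊕ y ═[ s ]⇒ no → x ═[ s ]⇒ no × y ═[ s ]⇒ no
  ⊕-⇒no⁻ (tau (⊕τL t) d)       = map₁ (tau t) (⊕-⇒no⁻ d)
  ⊕-⇒no⁻ (tau (⊕τR t) d)       = map₂ (tau t) (⊕-⇒no⁻ d)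
  ⊕-⇒no⁻ (tau ⊕end d)          = ⊥-elim (end⇏conclusive no d)
  ⊕-⇒no⁻ {s = s} (tau ⊕noL d)  = verdict-follows no s , d
  ⊕-⇒no⁻ {s = s} (tau ⊕noR d)  = d , verdict-follows no s
  ⊕-⇒no⁻ (tau ⊕yesL d)         = ⊥-elim (yes⇏no d)
  ⊕-⇒no⁻ (tau ⊕yesR d)         = ⊥-elim (yes⇏no d)
  ⊕-⇒no⁻ (step (⊕sync t u) d)  = map-× (step t) (step u) (⊕-⇒no⁻ d)

  ⊗-⇒yes⁻ : x ⊗ y ═[ s ]⇒ yes → x ═[ s ]⇒ yes × y ═[ s ]⇒ yes
  ⊗-⇒yes⁻ (tau (⊗τL t) d)       = map₁ (tau t) (⊗-⇒yes⁻ d)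
  ⊗-⇒yes⁻ (tau (⊗τR t) d)       = map₂ (tau t) (⊗-⇒yes⁻ d)
  ⊗-⇒yes⁻ (tau ⊗end d)          = ⊥-elim (end⇏conclusive yes d)
  ⊗-⇒yes⁻ {s = s} (tau ⊗yesL d) = verdict-follows yes s , d
  ⊗-⇒yes⁻ {s = s} (tau ⊗yesR d) = d , verdict-follows yes s
  ⊗-⇒yes⁻ (tau ⊗noL d)          = ⊥-elim (no⇏yes d)
  ⊗-⇒yes⁻ (tau ⊗noR d)          = ⊥-elim (no⇏yes d)
  ⊗-⇒yes⁻ (step (⊗sync t u) d)  = map-× (step t) (step u) (⊗-⇒yes⁻ d)

  Total : Mon n → Set
  Total m = ∀ s → ∃ λ m′ → m ═[ s ]⇒ m′

  Rejects-⊗ˡ : Total y → Rejects x g → Rejects (x ⊗ y) g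
  Rejects-⊗ˡ ty (s , p , d) = s , p , ⇒-τʳ (⊗-⇒ d (proj₂ (ty s))) ⊗noL

  Rejects-⊗ʳ : Total x → Rejects y g → Rejects (x ⊗ y) g
  Rejects-⊗ʳ tx (s , p , d) = s , p , ⇒-τʳ (⊗-⇒ (proj₂ (tx s)) d) ⊗noR

  Accepts-⊕ˡ : Total y → Accepts x g → Accepts (x ⊕ y) g
  Accepts-⊕ˡ ty (s , p , d) = s , p , ⇒-τʳ (⊕-⇒ d (proj₂ (ty s))) ⊕yesL

  Accepts-⊕ʳ : Total x → Accepts y g → Accepts (x ⊕ y) g
  Accepts-⊕ʳ tx (s , p , d) = s , p , ⇒-τʳ (⊕-⇒ (proj₂ (tx s)) d) ⊕yesR

  Rejects-⊕ : Rejects x g → Rejects y g → Rejects (x ⊕ y) g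
  Rejects-⊕ (s , p , d) (t , q , e) with Prefix-compare s t p q
  ... | inj₁ (u , refl) = s ++ u , q , ⇒-τʳ (⊕-⇒ (⇒-extend no d u) e) ⊕noL
  ... | inj₂ (u , refl) = t ++ u , p , ⇒-τʳ (⊕-⇒ d (⇒-extend no e u)) ⊕noR

  Accepts-⊗ : Accepts x g → Accepts y g → Accepts (x ⊗ y) g
  Accepts-⊗ (s , p , d) (t , q , e) with Prefix-compare s t p q
  ... | inj₁ (u , refl) = s ++ u , q , ⇒-τʳ (⊗-⇒ (⇒-extend yes d u) e) ⊗yesL
  ... | inj₂ (u , refl) = t ++ u , p , ⇒-τʳ (⊗-⇒ d (⇒-extend yes e u)) ⊗yesR

  data Branch (A : Subset n) (m v : Mon n) (a : Fin n) : Mon n → Set where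
    inside  : a ∈ˢ A → Branch A m v a m
    outside : a ∉ A  → Branch A m v a v

  guards : Subset n → Mon n → Mon n → List (Mon n)
  guards A m v = map (λ a → a · m) (filterᵇ (inA A) (allFin n))
              ++ map (λ a → a · v) (filterᵇ (λ a → not (inA A a)) (allFin n))

  T-inA⇒∈ : T (inA A a) → a ∈ˢ A
  T-inA⇒∈ {A} {a} p = lookup⇒[]= a A (Equivalence.to T-≡ p)

  ∈⇒T-inA : a ∈ˢ A → T (inA A a)
  ∈⇒T-inA p = Equivalence.from T-≡ ([]=⇒lookup p)

  T-not-inA⇒∉ : T (not (inA A a)) → a ∉ A
  T-not-inA⇒∉ p a∈A = subst (T ∘ not) ([]=⇒lookup a∈A) p

  ∉⇒T-not-inA : a ∉ A → T (not (inA A a))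
  ∉⇒T-not-inA {a} {A} a∉A with inA A a in eq
  ... | true  = a∉A (lookup⇒[]= a A eq)
  ... | false = _

  ∈-guards⁻ : ∀ A m v {q} → q ∈ guards A m v → ∃₂ λ a x → q ≡ a · x × Branch A m v a x
  ∈-guards⁻ A m v i with ∈-++⁻ (map (λ a → a · m) (filterᵇ (inA A) (allFin n))) i
  ... | inj₁ j = let a , _ , eq , p = ∈-map∘filter⁻ (λ a → a · m) (T? ∘ inA A) {xs = allFin n} j
                 in a , m , eq , inside (T-inA⇒∈ p)
  ... | inj₂ j = let a , _ , eq , p = ∈-map∘filter⁻ (λ a → a · v) (T? ∘ not ∘ inA A) {xs = allFin n} j
                 in a , v , eq , outside (T-not-inA⇒∉ p)

  Sum-step⁺ : ∀ l {q α} → q ∈ l → q ─[ α ]→ x → Sum l ─[ α ]→ x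
  Sum-step⁺ (q ∷ [])    (here refl) t = t
  Sum-step⁺ (q ∷ r ∷ l) (here refl) t = sumL t
  Sum-step⁺ (q ∷ r ∷ l) (there i)   t = sumR (Sum-step⁺ (r ∷ l) i t)

  Sum-step⁻ : ∀ l {α} → Sum l ─[ α ]→ x → (∃ λ q → q ∈ l × q ─[ α ]→ x) ⊎ x ≡ end
  Sum-step⁻ []          (verd end) = inj₂ refl
  Sum-step⁻ (q ∷ [])    t          = inj₁ (q , here refl , t)
  Sum-step⁻ (q ∷ r ∷ l) (sumL t)   = inj₁ (q , here refl , t)
  Sum-step⁻ (q ∷ r ∷ l) (sumR t)   = map-⊎ (map₂ (map₁ there)) (λ e → e) (Sum-step⁻ (r ∷ l) t)

  Sum-conclusive⁻ : ∀ l → Conclusive (Sum l) → ∃ λ q → q ∈ l × Conclusive q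
  Sum-conclusive⁻ (q ∷ []) c = q , here refl , c

  guardSum-step∈ : a ∈ˢ A → guardSum A m v ─[ act a ]→ m
  guardSum-step∈ {a} {A} {m} {v} a∈A = Sum-step⁺ (guards A m v) (∈-++⁺ˡ
    (∈-map∘filter⁺ (λ a → a · m) (T? ∘ inA A) (a , ∈-allFin a , refl , ∈⇒T-inA a∈A))) pref

  guardSum-step∉ : a ∉ A → guardSum A m v ─[ act a ]→ v
  guardSum-step∉ {a} {A} {m} {v} a∉A = Sum-step⁺ (guards A m v) (∈-++⁺ʳ _
    (∈-map∘filter⁺ (λ a → a · v) (T? ∘ not ∘ inA A) (a , ∈-allFin a , refl , ∉⇒T-not-inA a∉A))) pref

  guardSum-step⁻ : ∀ A m v {α} → guardSum A m v ─[ α ]→ x →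
                   x ≡ end ⊎ ∃ λ a → α ≡ act a × Branch A m v a x
  guardSum-step⁻ A m v t with Sum-step⁻ (guards A m v) t
  ... | inj₂ x≡end = inj₁ x≡end
  ... | inj₁ (q , i , u) with ∈-guards⁻ A m v i
  ...   | a , _ , refl , b with u
  ...     | pref = inj₂ (a , refl , b)

  guardSum-inconclusive : ∀ A m v → ¬ Conclusive (guardSum A m v)
  guardSum-inconclusive A m v c with Sum-conclusive⁻ (guards A m v) c
  ... | _ , i , c′ with ∈-guards⁻ A m v i
  ...   | _ , _ , refl , _ with () ← c′

  guardSum-⇒⁻ : ∀ A m v → guardSum A m v ═[ s ]⇒ w → Conclusive w →
                ∃₂ λ a s′ → s ≡ a ∷ s′ × ∃ λ x → Branch A m v a x × x ═[ s′ ]⇒ w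
  guardSum-⇒⁻ A m v done       c = ⊥-elim (guardSum-inconclusive A m v c)
  guardSum-⇒⁻ A m v (tau t d)  c with guardSum-step⁻ A m v t
  ... | inj₁ refl = ⊥-elim (end⇏conclusive c d)
  guardSum-⇒⁻ A m v (step t d) c with guardSum-step⁻ A m v t
  ... | inj₁ refl            = ⊥-elim (end⇏conclusive c d)
  ... | inj₂ (a , refl , b)  = a , _ , refl , _ , b , d

  _[_≔_] : (Var → Mon n) → Var → Mon n → (Var → Mon n)
  (δ [ Y ≔ p ]) W with Y ≟ W
  ... | yes′ _ = p
  ... | no′  _ = δ W

  ≔-≢ : Y ≢ W → (δ [ Y ≔ p ]) W ≡ δ W
  ≔-≢ {Y} {W} Y≢W with Y ≟ W
  ... | yes′ Y≡W = ⊥-elim (Y≢W Y≡W)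
  ... | no′  _   = refl

  ≔-cong : W ∈ Y ∷ Θ → (W ∈ Θ → Y ≢ W → δ W ≡ δ′ W) → (δ [ Y ≔ p ]) W ≡ (δ′ [ Y ≔ p ]) W
  ≔-cong {W} {Y} w eq with Y ≟ W
  ... | yes′ _   = refl
  ... | no′ Y≢W = eq (tail (Y≢W ∘ sym) w) Y≢W

  EnvAll : ∀ {ℓ} → (Mon n → Set ℓ) → List Var → (Var → Mon n) → Set ℓ
  EnvAll P Γ δ = ∀ {W} → W ∈ Γ → P (δ W)

  EnvAll-≔ : ∀ {ℓ} {P : Mon n → Set ℓ} → P p → EnvAll P Γ δ → EnvAll P (Y ∷ Γ) (δ [ Y ≔ p ])
  EnvAll-≔ {Y = Y} p ps {W} w with Y ≟ W
  ... | yes′ _   = p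
  ... | no′ Y≢W = ps (tail (Y≢W ∘ sym) w)

  synthWith : (Var → Mon n) → Form n → Mon n
  synthWith δ tt        = yes
  synthWith δ ff        = no
  synthWith δ (box A φ) = guardSum A (synthWith δ φ) yes
  synthWith δ (dia A φ) = guardSum A (synthWith δ φ) no
  synthWith δ (φ ∨ᶠ ψ)  = synthWith δ φ ⊕ synthWith δ ψ
  synthWith δ (φ ∧ᶠ ψ)  = synthWith δ φ ⊗ synthWith δ ψ
  synthWith δ (max Y φ) = rec Y (synthWith (δ [ Y ≔ var Y ]) φ)
  synthWith δ (min Y φ) = rec Y (synthWith (δ [ Y ≔ var Y ]) φ)
  synthWith δ (var Y)   = δ Y

  synthWith-cong : Scoped Θ φ → (∀ {W} → W ∈ Θ → δ W ≡ δ′ W) → synthWith δ φ ≡ synthWith δ′ φ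
  synthWith-cong tt        eq = refl
  synthWith-cong ff        eq = refl
  synthWith-cong {φ = box A _} (box sc) eq = cong (λ m → guardSum A m yes) (synthWith-cong sc eq)
  synthWith-cong {φ = dia A _} (dia sc) eq = cong (λ m → guardSum A m no) (synthWith-cong sc eq)
  synthWith-cong (or s t)  eq = cong₂ _⊕_ (synthWith-cong s eq) (synthWith-cong t eq)
  synthWith-cong (and s t) eq = cong₂ _⊗_ (synthWith-cong s eq) (synthWith-cong t eq)
  synthWith-cong (max sc)  eq = cong (rec _) (synthWith-cong sc (λ w → ≔-cong w (λ w′ _ → eq w′)))
  synthWith-cong (min sc)  eq = cong (rec _) (synthWith-cong sc (λ w → ≔-cong w (λ w′ _ → eq w′)))
  synthWith-cong (var w)   eq = eq w

  var-≔-var : (var [ Y ≔ var Y ]) W ≡ var W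
  var-≔-var {Y} {W} with Y ≟ W
  ... | yes′ refl = refl
  ... | no′ _     = refl

  synth≡synthWith-var : Scoped Θ φ → synth φ ≡ synthWith var φ
  synth≡synthWith-var tt        = refl
  synth≡synthWith-var ff        = refl
  synth≡synthWith-var {φ = box A _} (box sc) = cong (λ m → guardSum A m yes) (synth≡synthWith-var sc)
  synth≡synthWith-var {φ = dia A _} (dia sc) = cong (λ m → guardSum A m no) (synth≡synthWith-var sc)
  synth≡synthWith-var (or s t)  = cong₂ _⊕_ (synth≡synthWith-var s) (synth≡synthWith-var t)
  synth≡synthWith-var (and s t) = cong₂ _⊗_ (synth≡synthWith-var s) (synth≡synthWith-var t)
  synth≡synthWith-var {φ = max Y _} (max sc) =
    cong (rec Y) (trans (synth≡synthWith-var sc) (synthWith-cong sc (λ _ → sym (var-≔-var {Y}))))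
  synth≡synthWith-var {φ = min Y _} (min sc) =
    cong (rec Y) (trans (synth≡synthWith-var sc) (synthWith-cong sc (λ _ → sym (var-≔-var {Y}))))
  synth≡synthWith-var (var _)   = refl

  var-[/]-≡ : var X [ p / X ] ≡ p
  var-[/]-≡ {X} with X ≟ X
  ... | yes′ _   = refl
  ... | no′ X≢X = ⊥-elim (X≢X refl)

  var-[/]-≢ : X ≢ Y → var Y [ p / X ] ≡ var Y
  var-[/]-≢ {X} {Y} X≢Y with X ≟ Y
  ... | yes′ X≡Y = ⊥-elim (X≢Y X≡Y)
  ... | no′ _    = refl

  Sum-[/] : ∀ l → Sum l [ p / X ] ≡ Sum (map (_[ p / X ]) l)
  Sum-[/] []          = refl
  Sum-[/] (q ∷ [])    = refl
  Sum-[/] (q ∷ r ∷ l) = cong (q [ _ / _ ] +ᵐ_) (Sum-[/] (r ∷ l))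

  guardSum-[/] : ∀ A m v → guardSum A m v [ p / X ] ≡ guardSum A (m [ p / X ]) (v [ p / X ])
  guardSum-[/] {p} {X} A m v = begin
    Sum (guards A m v) [ p / X ]                                 ≡⟨ Sum-[/] (guards A m v) ⟩
    Sum (map (_[ p / X ]) (map (λ a → a · m) ins ++ map (λ a → a · v) outs))
      ≡⟨ cong Sum (map-++ (_[ p / X ]) (map (λ a → a · m) ins) (map (λ a → a · v) outs)) ⟩
    Sum (map (_[ p / X ]) (map (λ a → a · m) ins) ++ map (_[ p / X ]) (map (λ a → a · v) outs))
      ≡⟨ cong Sum (cong₂ _++_ (sym (map-∘ ins)) (sym (map-∘ outs))) ⟩
    guardSum A (m [ p / X ]) (v [ p / X ])                        ∎
    where
      open ≡-Reasoning
      ins outs : List (Fin n)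
      ins  = filterᵇ (inA A) (allFin n)
      outs = filterᵇ (λ a → not (inA A a)) (allFin n)

  synthWith-[/] : Scoped Θ φ →
                  (∀ {W} → W ∈ Θ → δ W [ p / X ] ≡ δ′ W) →
                  (∀ {W} → W ∈ Θ → X ≢ W → δ W ≡ δ′ W) →
                  synthWith δ φ [ p / X ] ≡ synthWith δ′ φ
  rec-[/] : Scoped (Y ∷ Θ) φ →
            (∀ {W} → W ∈ Θ → δ W [ p / X ] ≡ δ′ W) →
            (∀ {W} → W ∈ Θ → X ≢ W → δ W ≡ δ′ W) →
            rec Y (synthWith (δ [ Y ≔ var Y ]) φ) [ p / X ] ≡ rec Y (synthWith (δ′ [ Y ≔ var Y ]) φ)
  synthWith-[/] tt        h₁ h₂ = refl
  synthWith-[/] ff        h₁ h₂ = refl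
  synthWith-[/] {φ = box A φ} {δ = δ} (box sc) h₁ h₂ =
    trans (guardSum-[/] A (synthWith δ φ) yes) (cong (λ m → guardSum A m yes) (synthWith-[/] sc h₁ h₂))
  synthWith-[/] {φ = dia A φ} {δ = δ} (dia sc) h₁ h₂ =
    trans (guardSum-[/] A (synthWith δ φ) no) (cong (λ m → guardSum A m no) (synthWith-[/] sc h₁ h₂))
  synthWith-[/] (or s t)  h₁ h₂ = cong₂ _⊕_ (synthWith-[/] s h₁ h₂) (synthWith-[/] t h₁ h₂)
  synthWith-[/] (and s t) h₁ h₂ = cong₂ _⊗_ (synthWith-[/] s h₁ h₂) (synthWith-[/] t h₁ h₂)
  synthWith-[/] (max sc)  h₁ h₂ = rec-[/] sc h₁ h₂
  synthWith-[/] (min sc)  h₁ h₂ = rec-[/] sc h₁ h₂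
  synthWith-[/] (var w)   h₁ h₂ = h₁ w

  rec-[/] {Y} {Θ} {δ = δ} {p} {X} {δ′} sc h₁ h₂ with X ≟ Y
  ... | yes′ refl = cong (rec Y) (synthWith-cong sc (λ w → ≔-cong w h₂))
  ... | no′ X≢Y   = cong (rec Y) (synthWith-[/] sc h₁′ (λ w X≢W → ≔-cong w (λ w′ _ → h₂ w′ X≢W)))
    where
      h₁′ : W ∈ Y ∷ Θ → (δ [ Y ≔ var Y ]) W [ p / X ] ≡ (δ′ [ Y ≔ var Y ]) W
      h₁′ {W} w with Y ≟ W
      ... | yes′ refl = var-[/]-≢ X≢Y
      ... | no′ Y≢W   = h₁ (tail (Y≢W ∘ sym) w)

  Closedᴹ : Mon n → Set
  Closedᴹ m = ∀ p X → m [ p / X ] ≡ m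

  synthWith-closed : Scoped Γ φ → EnvAll Closedᴹ Γ δ → Closedᴹ (synthWith δ φ)
  synthWith-closed sc cl p X = synthWith-[/] sc (λ w → cl w p X) (λ _ _ → refl)

  synthWith-unfold : Scoped (Y ∷ Γ) φ → EnvAll Closedᴹ Γ δ →
                     synthWith (δ [ Y ≔ var Y ]) φ [ p / Y ] ≡ synthWith (δ [ Y ≔ p ]) φ
  synthWith-unfold {Y} {Γ} {δ = δ} {p} sc cl =
    synthWith-[/] sc unfold-var (λ _ Y≢W → trans (≔-≢ Y≢W) (sym (≔-≢ Y≢W)))
    where
      unfold-var : W ∈ Y ∷ Γ → (δ [ Y ≔ var Y ]) W [ p / Y ] ≡ (δ [ Y ≔ p ]) W
      unfold-var {W} w with Y ≟ W
      ... | yes′ refl = var-[/]-≡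
      ... | no′ Y≢W   = cl (tail (Y≢W ∘ sym) w) p Y

  rec-unfold : Scoped (Y ∷ Γ) φ → EnvAll Closedᴹ Γ δ →
               let m = rec Y (synthWith (δ [ Y ≔ var Y ]) φ) in m ─[ τ ]→ synthWith (δ [ Y ≔ m ]) φ
  rec-unfold {Y = Y} {φ = φ} {δ = δ} sc cl =
    subst (rec Y (synthWith (δ [ Y ≔ var Y ]) φ) ─[ τ ]→_) (synthWith-unfold sc cl) rec

  rec-⇒⁻ : Scoped (Y ∷ Γ) φ → EnvAll Closedᴹ Γ δ →
           let m = rec Y (synthWith (δ [ Y ≔ var Y ]) φ) in
           m ═[ s ]⇒ w → Conclusive w → synthWith (δ [ Y ≔ m ]) φ ═[ s ]⇒ w
  rec-⇒⁻ sc cl (tau rec d)       _ = subst (_═[ _ ]⇒ _) (synthWith-unfold sc cl) d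
  rec-⇒⁻ sc cl (step (verd ()) _) _

  EnvAll-Closedᴹ-unfold : Scoped (Y ∷ Γ) φ → EnvAll Closedᴹ Γ δ →
                          EnvAll Closedᴹ (Y ∷ Γ) (δ [ Y ≔ rec Y (synthWith (δ [ Y ≔ var Y ]) φ) ])
  EnvAll-Closedᴹ-unfold sc cl = EnvAll-≔ {P = Closedᴹ} (synthWith-closed (max sc) cl) cl

  -- Synthesised monitors never get stuck

  GuardedIn-max⁻ : Y ≢ W → GuardedIn W (max Y φ) → GuardedIn W φ
  GuardedIn-max⁻ Y≢W max-shadow = ⊥-elim (Y≢W refl)
  GuardedIn-max⁻ _   (max g)    = g

  GuardedIn-min⁻ : Y ≢ W → GuardedIn W (min Y φ) → GuardedIn W φ
  GuardedIn-min⁻ Y≢W min-shadow = ⊥-elim (Y≢W refl)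
  GuardedIn-min⁻ _   (min g)    = g

  ¬GuardedIn-var : ¬ GuardedIn X (var {n} X)
  ¬GuardedIn-var (var X≢X) = X≢X refl

  data Runnable : Mon n → Set where
    yes : Runnable yes
    no  : Runnable no
    _⊗_ : Runnable x → Runnable y → Runnable (x ⊗ y)
    _⊕_ : Runnable x → Runnable y → Runnable (x ⊕ y)
    synthesised : Guarded φ → Scoped Γ φ → EnvAll Closedᴹ Γ δ → EnvAll Runnable Γ δ →
                  Runnable (synthWith δ φ)

  Follows : Mon n → Fin n → Set
  Follows m a = ∃ λ m′ → m ═[ a ∷ [] ]⇒ m′ × Runnable m′

  Follows-⊗ : Follows x a → Follows y a → Follows (x ⊗ y) a
  Follows-⊗ (x′ , d , r) (y′ , e , r′) = x′ ⊗ y′ , ⊗-⇒ d e , r ⊗ r′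

  Follows-⊕ : Follows x a → Follows y a → Follows (x ⊕ y) a
  Follows-⊕ (x′ , d , r) (y′ , e , r′) = x′ ⊕ y′ , ⊕-⇒ d e , r ⊕ r′

  follows : Runnable m → ∀ a → Follows m a
  -- Only unguarded variables must follow a; this breaks the circularity at rec X.m, where X is guarded.
  synthWith-follows : Guarded φ → Scoped Γ φ → EnvAll Closedᴹ Γ δ → EnvAll Runnable Γ δ →
                      (∀ {W} → W ∈ Γ → ¬ GuardedIn W φ → Follows (δ W) a) → Follows (synthWith δ φ) a
  rec-follows : GuardedIn Y φ → Guarded φ → Scoped (Y ∷ Γ) φ → EnvAll Closedᴹ Γ δ → EnvAll Runnable Γ δ →
                let m = rec Y (synthWith (δ [ Y ≔ var Y ]) φ) in Runnable m →
                (∀ {W} → W ∈ Γ → Y ≢ W → ¬ GuardedIn W φ → Follows (δ W) a) → Follows m a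

  follows yes      a = yes , step (verd yes) done , yes
  follows no       a = no , step (verd no) done , no
  follows (r ⊗ r′) a = Follows-⊗ (follows r a) (follows r′ a)
  follows (r ⊕ r′) a = Follows-⊕ (follows r a) (follows r′ a)
  follows (synthesised gd sc cl rs) a = synthWith-follows gd sc cl rs (λ w _ → follows (rs w) a)

  synthWith-follows tt tt _ _ _ = yes , step (verd yes) done , yes
  synthWith-follows ff ff _ _ _ = no , step (verd no) done , no
  synthWith-follows {φ = box A _} {a = a} (box gd) (box sc) cl rs _ with a ∈? A
  ... | yes′ a∈A = _ , step (guardSum-step∈ a∈A) done , synthesised gd sc cl rs
  ... | no′ a∉A  = _ , step (guardSum-step∉ a∉A) done , yes
  synthWith-follows {φ = dia A _} {a = a} (dia gd) (dia sc) cl rs _ with a ∈? A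
  ... | yes′ a∈A = _ , step (guardSum-step∈ a∈A) done , synthesised gd sc cl rs
  ... | no′ a∉A  = _ , step (guardSum-step∉ a∉A) done , no
  synthWith-follows (or g₁ g₂) (or s₁ s₂) cl rs h =
    Follows-⊕ (synthWith-follows g₁ s₁ cl rs (λ w ng → h w λ { (or g _) → ng g }))
              (synthWith-follows g₂ s₂ cl rs (λ w ng → h w λ { (or _ g) → ng g }))
  synthWith-follows (and g₁ g₂) (and s₁ s₂) cl rs h =
    Follows-⊗ (synthWith-follows g₁ s₁ cl rs (λ w ng → h w λ { (and g _) → ng g }))
              (synthWith-follows g₂ s₂ cl rs (λ w ng → h w λ { (and _ g) → ng g }))
  synthWith-follows (max gin gd) (max sc) cl rs h =
    rec-follows gin gd sc cl rs (synthesised (max gin gd) (max sc) cl rs)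
      (λ w Y≢W ng → h w (ng ∘ GuardedIn-max⁻ Y≢W))
  synthWith-follows (min gin gd) (min sc) cl rs h =
    rec-follows gin gd sc cl rs (synthesised (min gin gd) (min sc) cl rs)
      (λ w Y≢W ng → h w (ng ∘ GuardedIn-min⁻ Y≢W))
  synthWith-follows var (var w) _ _ h = h w ¬GuardedIn-var

  rec-follows {Y} {φ} {Γ} {δ} {a} gin gd sc cl rs r h =
    let x , d , r′ = synthWith-follows gd sc (EnvAll-Closedᴹ-unfold sc cl) (EnvAll-≔ {P = Runnable} r rs) h′ in
    x , tau (rec-unfold sc cl) d , r′
    where
      h′ : W ∈ Y ∷ Γ → ¬ GuardedIn W φ → Follows ((δ [ Y ≔ rec Y (synthWith (δ [ Y ≔ var Y ]) φ) ]) W) a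
      h′ {W} w ng with Y ≟ W
      ... | yes′ refl = ⊥-elim (ng gin)
      ... | no′ Y≢W   = h (tail (Y≢W ∘ sym) w) Y≢W ng

  Runnable⇒Total : Runnable m → Total m
  Runnable⇒Total {m} r []      = m , done
  Runnable⇒Total     r (a ∷ s) = let _ , d , r′ = follows r a in map₂ (⇒-++ d) (Runnable⇒Total r′ s)

  -- Soundness

  -- A variable guarded in φ is only reached after a visible action, hence along a strictly shorter trace.
  NoRejectionUpTo : ℕ → List Var → Form n → (Var → Mon n) → Env n → Set
  NoRejectionUpTo k Γ φ δ ρ = ∀ {W} → W ∈ Γ → ∀ {h t} → ρ W h → Prefix t h → length t ≤ k →
                              (GuardedIn W φ → length t < k) → ¬ (δ W ═[ t ]⇒ no)

  NoRejectionUpTo-< : j < k → NoRejectionUpTo k Γ φ δ ρ → NoRejectionUpTo j Γ ψ δ ρ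
  NoRejectionUpTo-< j<k H w r pt lt _ = H w r pt (≤-trans lt (<⇒≤ j<k)) (λ _ → ≤-<-trans lt j<k)

  NoRejectionUpTo-sub : (∀ {W} → GuardedIn W φ → GuardedIn W ψ) →
                        NoRejectionUpTo k Γ φ δ ρ → NoRejectionUpTo k Γ ψ δ ρ
  NoRejectionUpTo-sub f H w r pt lt lt′ = H w r pt lt (lt′ ∘ f)

  NoRejectionUpTo-≔ : ∀ {S : TSet n} → (∀ {W} → Y ≢ W → GuardedIn W ψ → GuardedIn W φ) →
                      (∀ {h t} → S h → Prefix t h → length t ≤ k →
                                 (GuardedIn Y φ → length t < k) → ¬ (p ═[ t ]⇒ no)) →
                      NoRejectionUpTo k Γ ψ δ ρ → NoRejectionUpTo k (Y ∷ Γ) φ (δ [ Y ≔ p ]) (ρ [ Y ↦ S ])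
  NoRejectionUpTo-≔ {Y} f HY H {W} w with Y ≟ W
  ... | yes′ refl = HY
  ... | no′ Y≢W   = λ r pt lt lt′ → H (tail (Y≢W ∘ sym) w) r pt lt (lt′ ∘ f Y≢W)

  rejection-sound : Acc _<_ k → Guarded φ → Scoped Γ φ → EnvAll Closedᴹ Γ δ → NoRejectionUpTo k Γ φ δ ρ →
                    ⟦ φ ⟧ ρ g → Prefix s g → length s ≤ k → ¬ (synthWith δ φ ═[ s ]⇒ no)
  rejection-sound _ tt tt _ _ _ _ _ = yes⇏no
  rejection-sound _ ff ff _ _ (lift ())
  rejection-sound {φ = box A φ} {δ = δ} (acc <k) (box gd) (box sc) cl H sem ps l d
    with guardSum-⇒⁻ A (synthWith δ φ) yes d no
  ... | _ , _ , refl , _ , outside _ , d′ = yes⇏no d′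
  ... | _ , _ , refl , _ , inside a∈A , d′ =
    let _ , ps′ , sem′ = Box-Prefix⁻ ps sem a∈A in
    rejection-sound (<k l) gd sc cl (NoRejectionUpTo-< l H) sem′ ps′ ≤-refl d′
  rejection-sound {φ = dia A φ} {δ = δ} (acc <k) (dia gd) (dia sc) cl H sem ps l d
    with guardSum-⇒⁻ A (synthWith δ φ) no d no
  ... | _ , _ , refl , _ , outside a∉A , _ = a∉A (proj₁ (Dia-Prefix⁻ ps sem))
  ... | _ , _ , refl , _ , inside _ , d′ =
    let _ , _ , ps′ , sem′ = Dia-Prefix⁻ ps sem in
    rejection-sound (<k l) gd sc cl (NoRejectionUpTo-< l H) sem′ ps′ ≤-refl d′
  rejection-sound ac (or g₁ g₂) (or s₁ s₂) cl H (inj₁ sem) ps l d =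
    rejection-sound ac g₁ s₁ cl (NoRejectionUpTo-sub (λ { (or g _) → g }) H) sem ps l (proj₁ (⊕-⇒no⁻ d))
  rejection-sound ac (or g₁ g₂) (or s₁ s₂) cl H (inj₂ sem) ps l d =
    rejection-sound ac g₂ s₂ cl (NoRejectionUpTo-sub (λ { (or _ g) → g }) H) sem ps l (proj₂ (⊕-⇒no⁻ d))
  rejection-sound ac (and g₁ g₂) (and s₁ s₂) cl H (sem₁ , sem₂) ps l d with ⊗-⇒no⁻ d
  ... | inj₁ d₁ = rejection-sound ac g₁ s₁ cl (NoRejectionUpTo-sub (λ { (and g _) → g }) H) sem₁ ps l d₁
  ... | inj₂ d₂ = rejection-sound ac g₂ s₂ cl (NoRejectionUpTo-sub (λ { (and _ g) → g }) H) sem₂ ps l d₂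
  rejection-sound {k} {φ = max Y φ} {Γ} {δ} {ρ} ac@(acc <k) (max gin gd) (max sc) cl H (S , post , Sg) ps l d =
    rejection-sound ac gd sc (EnvAll-Closedᴹ-unfold sc cl) H′ (post _ Sg) ps l
      (rec-⇒⁻ sc cl d no)
    where
      -- (S , post , Sh) witnesses h ∈ ⟦ max Y φ ⟧ ρ, and lt gin shortens the prefix.
      H′ : NoRejectionUpTo k (Y ∷ Γ) φ (δ [ Y ≔ synthWith δ (max Y φ) ]) (ρ [ Y ↦ S ])
      H′ = NoRejectionUpTo-≔ GuardedIn-max⁻
             (λ Sh pt _ lt → rejection-sound (<k (lt gin)) (max gin gd) (max sc) cl
                               (NoRejectionUpTo-< (lt gin) H) (S , post , Sh) pt ≤-refl)
             H
  rejection-sound {k} {φ = min Y φ} {δ = δ} ac (min _ gd) (min sc) cl H sem ps l d = sem S S-prefixed ps l d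
    where
      S : TSet n
      S h = ∀ {t} → Prefix t h → length t ≤ k → ¬ (synthWith δ (min Y φ) ═[ t ]⇒ no)
      S-prefixed : ∀ h → ⟦ φ ⟧ (_ [ Y ↦ S ]) h → S h
      S-prefixed h sem′ pt lt d′ =
        rejection-sound ac gd sc (EnvAll-Closedᴹ-unfold sc cl)
          (NoRejectionUpTo-≔ GuardedIn-min⁻ (λ Sh pt lt _ → Sh pt lt) H) sem′ pt lt (rec-⇒⁻ sc cl d′ no)
  rejection-sound _ var (var w) _ H (lift r) ps l = H w r ps l (⊥-elim ∘ ¬GuardedIn-var)

  AcceptanceUpTo : ℕ → List Var → Form n → (Var → Mon n) → Env n → Set
  AcceptanceUpTo k Γ φ δ ρ = ∀ {W} → W ∈ Γ → ∀ {h t} → Prefix t h → length t ≤ k →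
                             (GuardedIn W φ → length t < k) → δ W ═[ t ]⇒ yes → ρ W h

  AcceptanceUpTo-< : j < k → AcceptanceUpTo k Γ φ δ ρ → AcceptanceUpTo j Γ ψ δ ρ
  AcceptanceUpTo-< j<k H w pt lt _ = H w pt (≤-trans lt (<⇒≤ j<k)) (λ _ → ≤-<-trans lt j<k)

  AcceptanceUpTo-sub : (∀ {W} → GuardedIn W φ → GuardedIn W ψ) →
                       AcceptanceUpTo k Γ φ δ ρ → AcceptanceUpTo k Γ ψ δ ρ
  AcceptanceUpTo-sub f H w pt lt lt′ = H w pt lt (lt′ ∘ f)

  AcceptanceUpTo-≔ : ∀ {S : TSet n} → (∀ {W} → Y ≢ W → GuardedIn W ψ → GuardedIn W φ) →
                     (∀ {h t} → Prefix t h → length t ≤ k → (GuardedIn Y φ → length t < k) → p ═[ t ]⇒ yes → S h) →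
                     AcceptanceUpTo k Γ ψ δ ρ → AcceptanceUpTo k (Y ∷ Γ) φ (δ [ Y ≔ p ]) (ρ [ Y ↦ S ])
  AcceptanceUpTo-≔ {Y} f HY H {W} w with Y ≟ W
  ... | yes′ refl = HY
  ... | no′ Y≢W   = λ pt lt lt′ → H (tail (Y≢W ∘ sym) w) pt lt (lt′ ∘ f Y≢W)

  acceptance-sound : Acc _<_ k → Guarded φ → Scoped Γ φ → EnvAll Closedᴹ Γ δ → AcceptanceUpTo k Γ φ δ ρ →
                     Prefix s g → length s ≤ k → synthWith δ φ ═[ s ]⇒ yes → ⟦ φ ⟧ ρ g
  acceptance-sound _ tt tt _ _ _ _ _ = _
  acceptance-sound _ ff ff _ _ _ _ d = ⊥-elim (no⇏yes d)
  acceptance-sound {φ = box A φ} {δ = δ} (acc <k) (box gd) (box sc) cl H ps l d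
    with guardSum-⇒⁻ A (synthWith δ φ) yes d yes
  ... | _ , _ , refl , _ , outside a∉A , _ = Box-Prefix⁺ ps (λ _ a∈A → ⊥-elim (a∉A a∈A))
  ... | _ , _ , refl , _ , inside _ , d′ =
    Box-Prefix⁺ ps (λ ps′ _ → acceptance-sound (<k l) gd sc cl (AcceptanceUpTo-< l H) ps′ ≤-refl d′)
  acceptance-sound {φ = dia A φ} {δ = δ} (acc <k) (dia gd) (dia sc) cl H ps l d
    with guardSum-⇒⁻ A (synthWith δ φ) no d yes
  ... | _ , _ , refl , _ , outside _ , d′ = ⊥-elim (no⇏yes d′)
  ... | _ , _ , refl , _ , inside a∈A , d′ =
    Dia-Prefix⁺ ps a∈A (λ ps′ → acceptance-sound (<k l) gd sc cl (AcceptanceUpTo-< l H) ps′ ≤-refl d′)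
  acceptance-sound ac (or g₁ g₂) (or s₁ s₂) cl H ps l d with ⊕-⇒yes⁻ d
  ... | inj₁ d₁ = inj₁ (acceptance-sound ac g₁ s₁ cl (AcceptanceUpTo-sub (λ { (or g _) → g }) H) ps l d₁)
  ... | inj₂ d₂ = inj₂ (acceptance-sound ac g₂ s₂ cl (AcceptanceUpTo-sub (λ { (or _ g) → g }) H) ps l d₂)
  acceptance-sound ac (and g₁ g₂) (and s₁ s₂) cl H ps l d =
    acceptance-sound ac g₁ s₁ cl (AcceptanceUpTo-sub (λ { (and g _) → g }) H) ps l (proj₁ (⊗-⇒yes⁻ d)) ,
    acceptance-sound ac g₂ s₂ cl (AcceptanceUpTo-sub (λ { (and _ g) → g }) H) ps l (proj₂ (⊗-⇒yes⁻ d))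
  acceptance-sound {k} {φ = max Y φ} {δ = δ} {s = s} ac (max _ gd) (max sc) cl H ps l d = S , S-post , (s , ps , l , d)
    where
      S : TSet n
      S h = ∃ λ t → Prefix t h × length t ≤ k × synthWith δ (max Y φ) ═[ t ]⇒ yes
      S-post : ∀ h → S h → ⟦ φ ⟧ (_ [ Y ↦ S ]) h
      S-post h (t , pt , lt , d′) =
        acceptance-sound ac gd sc (EnvAll-Closedᴹ-unfold sc cl)
          (AcceptanceUpTo-≔ GuardedIn-max⁻ (λ pt lt _ d → _ , pt , lt , d) H) pt lt (rec-⇒⁻ sc cl d′ yes)
  acceptance-sound {k} {φ = min Y φ} {Γ} {δ} {ρ} ac@(acc <k) (min gin gd) (min sc) cl H ps l d S S-pre =
    S-pre _ (acceptance-sound ac gd sc (EnvAll-Closedᴹ-unfold sc cl) H′ ps l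
              (rec-⇒⁻ sc cl d yes))
    where
      -- lt gin shortens the prefix, and ⟦ min Y φ ⟧ ρ ⊆ S via S-pre.
      H′ : AcceptanceUpTo k (Y ∷ Γ) φ (δ [ Y ≔ synthWith δ (min Y φ) ]) (ρ [ Y ↦ S ])
      H′ = AcceptanceUpTo-≔ GuardedIn-min⁻
             (λ pt _ lt d′ → acceptance-sound (<k (lt gin)) (min gin gd) (min sc) cl
                               (AcceptanceUpTo-< (lt gin) H) pt ≤-refl d′ S S-pre)
             H
  acceptance-sound _ var (var w) _ H ps l d = lift (H w ps l (⊥-elim ∘ ¬GuardedIn-var) d)

  -- Completeness

  EnvRel : ∀ {ℓ} → (Mon n → TSet n → Set ℓ) → List Var → (Var → Mon n) → Env n → Set ℓ
  EnvRel R Γ δ ρ = ∀ {W} → W ∈ Γ → R (δ W) (ρ W)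

  EnvRel-≔ : ∀ {ℓ} {R : Mon n → TSet n → Set ℓ} {S} → R p S → EnvRel R Γ δ ρ →
             EnvRel R (Y ∷ Γ) (δ [ Y ≔ p ]) (ρ [ Y ↦ S ])
  EnvRel-≔ {Y = Y} r H {W} w with Y ≟ W
  ... | yes′ _   = r
  ... | no′ Y≢W = H (tail (Y≢W ∘ sym) w)

  decide : ExcludedMiddle (suc zero) → (P : Set) → Dec P
  decide em P = map′ lower lift (em {Lift _ P})

  ¬Rejects-⊕ : ExcludedMiddle (suc zero) → ¬ Rejects (x ⊕ y) g → ¬ Rejects x g ⊎ ¬ Rejects y g
  ¬Rejects-⊕ {x} {y} {g} em nr with decide em (Rejects x g) | decide em (Rejects y g)
  ... | no′ ¬rx | _       = inj₁ ¬rx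
  ... | yes′ _  | no′ ¬ry = inj₂ ¬ry
  ... | yes′ rx | yes′ ry = ⊥-elim (nr (Rejects-⊕ rx ry))

  NotRejectedIn : Mon n → TSet n → Set
  NotRejectedIn m T = ∀ {h} → ¬ Rejects m h → T h

  violation-complete : ExcludedMiddle (suc zero) → InS φ → Guarded φ → Scoped Γ φ →
                       EnvAll Closedᴹ Γ δ → EnvAll Runnable Γ δ → EnvRel NotRejectedIn Γ δ ρ →
                       ¬ Rejects (synthWith δ φ) g → ⟦ φ ⟧ ρ g
  violation-complete em tt tt tt _ _ _ _ = _
  violation-complete em ff ff ff _ _ _ nr = ⊥-elim (nr ([] , _ , done))
  violation-complete em (box iS) (box gd) (box sc) cl rs H nr = Box⁺ λ c a∈A →
    violation-complete em iS gd sc cl rs H λ (s , p , d) → nr (_ ∷ s , Prefix-∷⁺ c p , step (guardSum-step∈ a∈A) d)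
  violation-complete em (or i₁ i₂) (or g₁ g₂) (or s₁ s₂) cl rs H nr =
    map-⊎ (violation-complete em i₁ g₁ s₁ cl rs H) (violation-complete em i₂ g₂ s₂ cl rs H) (¬Rejects-⊕ em nr)
  violation-complete em (and i₁ i₂) (and g₁ g₂) (and s₁ s₂) cl rs H nr =
    violation-complete em i₁ g₁ s₁ cl rs H (nr ∘ Rejects-⊗ˡ (Runnable⇒Total (synthesised g₂ s₂ cl rs))) ,
    violation-complete em i₂ g₂ s₂ cl rs H (nr ∘ Rejects-⊗ʳ (Runnable⇒Total (synthesised g₁ s₁ cl rs)))
  violation-complete {φ = max Y φ} {δ = δ} em (max iS) (max gin gd) (max sc) cl rs H nr = S , S-post , nr
    where
      S : TSet n
      S h = ¬ Rejects (synthWith δ (max Y φ)) h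
      S-post : ∀ h → S h → ⟦ φ ⟧ (_ [ Y ↦ S ]) h
      S-post h nh =
        violation-complete em iS gd sc
          (EnvAll-Closedᴹ-unfold sc cl)
          (EnvAll-≔ {P = Runnable} (synthesised (max gin gd) (max sc) cl rs) rs)
          (EnvRel-≔ {R = NotRejectedIn} (λ nr′ → nr′) H)
          λ (s , p , d) → nh (s , p , tau (rec-unfold sc cl) d)
  violation-complete em var var (var w) _ _ H nr = lift (H w nr)

  AcceptedOn : Mon n → TSet n → Set
  AcceptedOn m T = ∀ {h} → T h → Accepts m h

  satisfaction-complete : InC φ → Guarded φ → Scoped Γ φ →
                          EnvAll Closedᴹ Γ δ → EnvAll Runnable Γ δ → EnvRel AcceptedOn Γ δ ρ →
                          ⟦ φ ⟧ ρ g → Accepts (synthWith δ φ) g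
  satisfaction-complete tt tt tt _ _ _ _ = [] , _ , done
  satisfaction-complete ff ff ff _ _ _ (lift ())
  satisfaction-complete (dia iC) (dia gd) (dia sc) cl rs H sem =
    let a , _ , c , a∈A , sem′ = Dia⁻ sem
        s , p , d = satisfaction-complete iC gd sc cl rs H sem′
    in a ∷ s , Prefix-∷⁺ c p , step (guardSum-step∈ a∈A) d
  satisfaction-complete (or i₁ i₂) (or g₁ g₂) (or s₁ s₂) cl rs H (inj₁ sem) =
    Accepts-⊕ˡ (Runnable⇒Total (synthesised g₂ s₂ cl rs)) (satisfaction-complete i₁ g₁ s₁ cl rs H sem)
  satisfaction-complete (or i₁ i₂) (or g₁ g₂) (or s₁ s₂) cl rs H (inj₂ sem) =
    Accepts-⊕ʳ (Runnable⇒Total (synthesised g₁ s₁ cl rs)) (satisfaction-complete i₂ g₂ s₂ cl rs H sem)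
  satisfaction-complete (and i₁ i₂) (and g₁ g₂) (and s₁ s₂) cl rs H (sem₁ , sem₂) =
    Accepts-⊗ (satisfaction-complete i₁ g₁ s₁ cl rs H sem₁) (satisfaction-complete i₂ g₂ s₂ cl rs H sem₂)
  satisfaction-complete {φ = min Y φ} {δ = δ} (min iC) (min gin gd) (min sc) cl rs H sem = sem S S-pre
    where
      S : TSet n
      S = Accepts (synthWith δ (min Y φ))
      S-pre : ∀ h → ⟦ φ ⟧ (_ [ Y ↦ S ]) h → S h
      S-pre h sem′ =
        let s , p , d = satisfaction-complete iC gd sc
                          (EnvAll-Closedᴹ-unfold sc cl)
                          (EnvAll-≔ {P = Runnable} (synthesised (min gin gd) (min sc) cl rs) rs)
                          (EnvRel-≔ {R = AcceptedOn} (λ a → a) H) sem′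
        in s , p , tau (rec-unfold sc cl) d
  satisfaction-complete var var (var w) _ _ H sem = H w (lower sem)

  synth-sound : Closed ψ → Guarded ψ → Sound (synth ψ) ψ
  synth-sound cl gd rewrite synth≡synthWith-var cl =
    (λ { g (s , ps , d) sem → rejection-sound (<-wellFounded (length s)) gd cl (λ ()) (λ ()) sem ps ≤-refl d }) ,
    (λ { g (s , ps , d) → acceptance-sound (<-wellFounded (length s)) gd cl (λ ()) (λ ()) ps ≤-refl d })

  synth-violation-complete : ExcludedMiddle (suc zero) → InS ψ → Closed ψ → Guarded ψ →
                             ViolationComplete (synth ψ) ψ
  synth-violation-complete em iS cl gd g ¬sem rewrite synth≡synthWith-var cl =
    decidable-stable (decide em _) (¬sem ∘ violation-complete em iS gd cl (λ ()) (λ ()) (λ ()))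

  synth-satisfaction-complete : InC ψ → Closed ψ → Guarded ψ → SatisfactionComplete (synth ψ) ψ
  synth-satisfaction-complete iC cl gd g sem rewrite synth≡synthWith-var cl =
    satisfaction-complete iC gd cl (λ ()) (λ ()) (λ ()) sem

mainTheorem9 : ExcludedMiddle (suc zero) →
    (k : ℕ) →
    ((ψ : Form (ℕ.suc k)) → InS ψ → Closed ψ → Guarded ψ →
      Sound (synth ψ) ψ × ViolationComplete (synth ψ) ψ)
    ×
    ((ψ : Form (ℕ.suc k)) → InC ψ → Closed ψ → Guarded ψ →
      Sound (synth ψ) ψ × SatisfactionComplete (synth ψ) ψ)
mainTheorem9 em k =
  (λ ψ iS cl gd → synth-sound cl gd , synth-violation-complete em iS cl gd) ,
  (λ ψ iC cl gd → synth-sound cl gd , synth-satisfaction-complete iC cl gd)
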